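{- For any $k,h\in\mathbb{N}$ there exists a graph $G$ such that $G\notin\mathrm{TD}_k$ and $G\notin\mathrm{MW}_h$, but $G\in\mathrm{TD}_1\mathrm{MW}_0$.
   Context: Graphs are finite and simple. Operations: $\circ,\bullet$ return the empty and the one-vertex graph; $\mathrm{Union}_t$ ($t\ge2$) is disjoint union; $\mathrm{Join}_t$ is disjoint union plus all edges between different arguments; $\mathrm{Inc}_{x,E_x}(G)=(V\cup\{x\},E\cup E_x)$ for $G=(V,E)$, $x\notin V$, $E_x\subseteq\{\{x,v\}\mid v\in V\}$; $\mathrm{Subst}_H(G_1,\dots,G_t)$ for $V(H)=\{v_1,\dots,v_t\}$ replaces each $v_i$ by a disjoint copy of $G_i$ and adds all edges between $V(G_i)$ and $V(G_j)$ whenever $\{v_i,v_j\}\in E(H)$. A graph has an algebraic expression over a set of operations if it is (up to renaming) the value of it; the empty graph corresponds to the empty expression. The nesting depth of an operation is the maximum number of expression-tree nodes labelled by it on a root-to-leaf path. $\mathrm{TD}_k$: graphs with an expression over $\{\circ,\mathrm{Union}\}\cup\{\mathrm{Inc}_{x,E_x}\}$ with $\mathrm{Inc}$ nesting depth at most $k$. $\mathrm{MW}_h$: graphs with an expression over $\{\bullet,\mathrm{Union},\mathrm{Join}\}\cup\{\mathrm{Subst}_H\mid|V(H)|\le h\}$. $\mathrm{TD}_k\mathrm{MW}_h$: graphs with an expression over $\{\circ,\bullet,\mathrm{Union},\mathrm{Join}\}\cup\{\mathrm{Inc}_{x,E_x}\}\cup\{\mathrm{Subst}_H\mid|V(H)|\le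 h\}$ with $\mathrm{Inc}$ nesting depth at most $k$. -}

module Defs where

open import Data.Nat using (ℕ; zero; suc; _≤_; _⊔_)
open import Data.Fin using (Fin; zero; suc; _≟_)
open import Data.Bool using (Bool; true; false)
open import Data.Empty using (⊥)
open import Data.Unit using (⊤)
open import Data.Maybe using (Maybe; just; nothing)
open import Data.Product using (Σ; _×_; _,_; ∃-syntax)
open import Data.Sum using (_⊎_)
open import Relation.Nullary using (¬_; yes; no)
open import Relation.Binary.PropositionalEquality using (_≡_; refl)
open import Function.Bundles using (_↔_; Inverse)

record Graph : Set where
  field
    n     : ℕ
    adj   : Fin n → Fin n → Bool
    sym   : ∀ u v → adj u v ≡ adj v u
    irref : ∀ u → adj u u ≡ false
open Graph public

-- Algebraic expressions, indexed by the vertex type of their value.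

data Expr : Set → Set₁ where
  circ   : Expr ⊥
  bullet : Expr ⊤
  union  : (t : ℕ) → 2 ≤ t → (Vs : Fin t → Set) →
           ((i : Fin t) → Expr (Vs i)) → Expr (Σ (Fin t) Vs)
  join   : (t : ℕ) → 2 ≤ t → (Vs : Fin t → Set) →
           ((i : Fin t) → Expr (Vs i)) → Expr (Σ (Fin t) Vs)
  -- Inc_{x,E_x}: new vertex x = nothing, E_x given by its neighbourhood N
  inc    : {V : Set} → Expr V → (N : V → Bool) → Expr (Maybe V)
  subst  : (t : ℕ) (H : Fin t → Fin t → Bool) →
           (∀ i j → H i j ≡ H j i) → (∀ i → H i i ≡ false) →
           (Vs : Fin t → Set) →
           ((i : Fin t) → Expr (Vs i)) → Expr (Σ (Fin t) Vs)

edge : {V : Set} → Expr V → V → V → Bool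
edge circ () _
edge bullet _ _ = false
edge (union t _ Vs es) (i , u) (j , v) with i ≟ j
... | yes refl = edge (es i) u v
... | no _     = false
edge (join t _ Vs es) (i , u) (j , v) with i ≟ j
... | yes refl = edge (es i) u v
... | no _     = true
edge (inc e N) nothing  nothing  = false
edge (inc e N) nothing  (just v) = N v
edge (inc e N) (just u) nothing  = N u
edge (inc e N) (just u) (just v) = edge e u v
edge (subst t H _ _ Vs es) (i , u) (j , v) with i ≟ j
... | yes refl = edge (es i) u v
... | no _     = H i j

maxFin : (t : ℕ) → (Fin t → ℕ) → ℕ
maxFin zero    f = 0
maxFin (suc t) f = f zero ⊔ maxFin t (λ i → f (suc i))

incDepth : {V : Set} → Expr V → ℕ
incDepth circ                 = 0
incDepth bullet               = 0
incDepth (union t _ Vs es)    = maxFin t (λ i → incDepth (es i))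
incDepth (join t _ Vs es)     = maxFin t (λ i → incDepth (es i))
incDepth (inc e N)            = suc (incDepth e)
incDepth (subst t _ _ _ Vs es) = maxFin t (λ i → incDepth (es i))

data Label : Set where
  circL bulletL unionL joinL incL : Label
  substL : ℕ → Label

AllNodes : (Label → Set) → {V : Set} → Expr V → Set
AllNodes P circ                  = P circL
AllNodes P bullet                = P bulletL
AllNodes P (union t _ Vs es)     = P unionL × (∀ i → AllNodes P (es i))
AllNodes P (join t _ Vs es)      = P joinL × (∀ i → AllNodes P (es i))
AllNodes P (inc e N)             = P incL × AllNodes P e
AllNodes P (subst t _ _ _ Vs es) = P (substL t) × (∀ i → AllNodes P (es i))

IsoTo : {V : Set} → Expr V → Graph → Set
IsoTo {V} e G = Σ (V ↔ Fin (n G)) λ f →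
  ∀ u v → edge e u v ≡ adj G (Inverse.to f u) (Inverse.to f v)

-- G has an expression over the allowed operations with Inc depth ≤ k
-- (the empty graph has the empty expression)
HasExpr : (Label → Set) → (ℕ → Set) → Graph → Set₁
HasExpr P D G = (n G ≡ 0) ⊎ (Σ Set λ V → Σ (Expr V) λ e →
                   AllNodes P e × D (incDepth e) × IsoTo e G)

TDops : Label → Set
TDops circL  = ⊤
TDops unionL = ⊤
TDops incL   = ⊤
TDops _      = ⊥

MWops : ℕ → Label → Set
MWops h bulletL    = ⊤
MWops h unionL     = ⊤
MWops h joinL      = ⊤
MWops h (substL t) = t ≤ h
MWops h _          = ⊥

TDMWops : ℕ → Label → Set
TDMWops h (substL t) = t ≤ h
TDMWops h _          = ⊤

TD : ℕ → Graph → Set₁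
TD k = HasExpr TDops (λ d → d ≤ k)

MW : ℕ → Graph → Set₁
MW h = HasExpr (MWops h) (λ _ → ⊤)

TDMW : ℕ → ℕ → Graph → Set₁
TDMW k h = HasExpr (TDMWops h) (λ d → d ≤ k)

{-# OPTIONS --safe #-}
-- The witness is the disjoint union of the clique K_{k+2} and the spider with
-- h + 2 legs (a centre joined to a_i, each a_i joined to b_i).  The clique is a
-- Join of single vertices and the spider one Inc over a Union of single edges,
-- so the witness lies in TD_1 MW_0.
-- A clique in a TD expression lies inside one argument of every Union, and
-- each Inc removes at most one of its vertices, so a clique of size k + 2
-- needs Inc depth k + 2.  In an MW expression the arguments of the topmost
-- Union, Join or Subst partition the vertices into modules.  The spider has no
-- nontrivial module, and a Union (centre ~ a_0), a Join (a_0 ≁ b_1) or a Subst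
-- on at most h vertices (pigeonhole on the h + 2 legs) puts two spider vertices
-- into one part, hence the whole spider; descending, it would end up inside a
-- single vertex, which is absurd.
module Submission where

open import Defs hiding (sym)
open import Axiom.UniquenessOfIdentityProofs using (module Decidable⇒UIP)
open import Data.Bool using (Bool; true; false)
open import Data.Empty using (⊥-elim)
open import Data.Fin using (Fin; zero; suc; _≟_)
open import Data.Fin.Properties using (0↔⊥; 1↔⊤; +↔⊎; pigeonhole; <⇒≢; suc-injective)
open import Data.Maybe using (Maybe; just; nothing; fromMaybe; maybe)
open import Data.Nat using (ℕ; suc; _+_; _≤_; _<_; z≤n; s≤s)
open import Data.Nat.Properties using (≤-trans; m≤m⊔n; m≤n⊔m; ⊔-lub; n≤1+n; <⇒≱)
open import Data.Product using (Σ; _×_; _,_; proj₁; proj₂)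
open import Data.Sum using (_⊎_; inj₁; inj₂; [_,_])
open import Data.Sum.Function.Propositional using (_⊎-↔_)
open import Data.Unit using (⊤; tt)
open import Data.Vec.Functional using ([]; _∷_)
open import Function using (_∘_; const)
open import Function.Bundles using (_↔_; Inverse; mk↔ₛ′)
open import Function.Properties.Inverse using (↔-sym; ↔-trans)
open import Relation.Nullary using (¬_; yes; no)
open import Relation.Nullary.Decidable using (does; dec-true; dec-false; dec-no; dec-yes-irr)
open import Relation.Binary.PropositionalEquality
  using (_≡_; refl; sym; trans; cong; cong₂; _≢_; module ≡-Reasoning)
  renaming (subst to ≡-subst)

≟-diag : ∀ {t} (i : Fin t) → (i ≟ i) ≡ yes refl
≟-diag i = dec-yes-irr (i ≟ i) (Decidable⇒UIP.≡-irrelevant _≟_) refl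

≡true⇒≢false : ∀ {b} → b ≡ true → b ≢ false
≡true⇒≢false refl ()

≡false⇒≢true : ∀ {b} → b ≡ false → b ≢ true
≡false⇒≢true refl ()

maxFin-upper : ∀ t f (i : Fin t) → f i ≤ maxFin t f
maxFin-upper (suc t) f zero    = m≤m⊔n _ _
maxFin-upper (suc t) f (suc i) = ≤-trans (maxFin-upper t (f ∘ suc) i) (m≤n⊔m (f zero) _)

maxFin-lub : ∀ t f {c} → (∀ i → f i ≤ c) → maxFin t f ≤ c
maxFin-lub 0       f bound = z≤n
maxFin-lub (suc t) f bound = ⊔-lub (bound zero) (maxFin-lub t (f ∘ suc) (bound ∘ suc))

-- Union, Join and Subst as compositions along a quotient graph

record IsComposition {t : ℕ} {Vs : Fin t → Set} (es : (i : Fin t) → Expr (Vs i))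
                     (ed : Σ (Fin t) Vs → Σ (Fin t) Vs → Bool)
                     (R : Fin t → Fin t → Bool) : Set where
  field
    edge-within : ∀ i u v → ed (i , u) (i , v) ≡ edge (es i) u v
    edge-across : ∀ {i j} u v → i ≢ j → ed (i , u) (j , v) ≡ R i j

module _ {t : ℕ} {Vs : Fin t → Set} {es : (i : Fin t) → Expr (Vs i)} where

  union-composition : (p : 2 ≤ t) → IsComposition es (edge (union t p Vs es)) (λ _ _ → false)
  union-composition p = record { edge-within = within ; edge-across = across }
    where
    within : ∀ i u v → edge (union t p Vs es) (i , u) (i , v) ≡ edge (es i) u v
    within i u v rewrite ≟-diag i = refl
    across : ∀ {i j} u v → i ≢ j → edge (union t p Vs es) (i , u) (j , v) ≡ false
    across {i} {j} u v i≢j rewrite dec-no (i ≟ j) i≢j = refl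

  join-composition : (p : 2 ≤ t) → IsComposition es (edge (join t p Vs es)) (λ _ _ → true)
  join-composition p = record { edge-within = within ; edge-across = across }
    where
    within : ∀ i u v → edge (join t p Vs es) (i , u) (i , v) ≡ edge (es i) u v
    within i u v rewrite ≟-diag i = refl
    across : ∀ {i j} u v → i ≢ j → edge (join t p Vs es) (i , u) (j , v) ≡ true
    across {i} {j} u v i≢j rewrite dec-no (i ≟ j) i≢j = refl

  subst-composition : ∀ H hs hi → IsComposition es (edge (subst t H hs hi Vs es)) H
  subst-composition H hs hi = record { edge-within = within ; edge-across = across }
    where
    within : ∀ i u v → edge (subst t H hs hi Vs es) (i , u) (i , v) ≡ edge (es i) u v
    within i u v rewrite ≟-diag i = refl
    across : ∀ {i j} u v → i ≢ j → edge (subst t H hs hi Vs es) (i , u) (j , v) ≡ H i j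
    across {i} {j} u v i≢j rewrite dec-no (i ≟ j) i≢j = refl

IsModular : ∀ {A : Set} {t} → (A → A → Bool) → (A → Fin t) → Set
IsModular adjA c = ∀ u v w → c u ≡ c v → c w ≢ c u → adjA u w ≡ adjA v w

module Composition {t : ℕ} {Vs : Fin t → Set} {es : (i : Fin t) → Expr (Vs i)}
                   {ed : Σ (Fin t) Vs → Σ (Fin t) Vs → Bool} {R : Fin t → Fin t → Bool}
                   (C : IsComposition es ed R) where
  open IsComposition C

  sym-edge : (∀ i j → R i j ≡ R j i) → (∀ i u v → edge (es i) u v ≡ edge (es i) v u) →
             ∀ x y → ed x y ≡ ed y x
  sym-edge R-sym es-sym (i , u) (j , v) with i ≟ j
  ... | yes refl = trans (edge-within i u v) (trans (es-sym i u v) (sym (edge-within i v u)))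
  ... | no i≢j   = trans (edge-across u v i≢j) (trans (R-sym i j) (sym (edge-across v u (i≢j ∘ sym))))

  same-part : ∀ x y → ed x y ≢ R (proj₁ x) (proj₁ y) → proj₁ x ≡ proj₁ y
  same-part (i , u) (j , v) ed≢R with i ≟ j
  ... | yes i≡j = i≡j
  ... | no i≢j  = ⊥-elim (ed≢R (edge-across u v i≢j))

  modular : ∀ {A : Set} {adjA : A → A → Bool} (g : A → Σ (Fin t) Vs) →
            (∀ u v → ed (g u) (g v) ≡ adjA u v) → IsModular adjA (proj₁ ∘ g)
  modular {adjA = adjA} g copy u v w cu≡cv cw≢cu = begin
    adjA u w                    ≡⟨ sym (copy u w) ⟩
    ed (g u) (g w)              ≡⟨ edge-across _ _ (cw≢cu ∘ sym) ⟩
    R (proj₁ (g u)) (proj₁ (g w)) ≡⟨ cong (λ i → R i (proj₁ (g w))) cu≡cv ⟩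
    R (proj₁ (g v)) (proj₁ (g w)) ≡⟨ sym (edge-across _ _ (cw≢cu ∘ sym ∘ trans cu≡cv)) ⟩
    ed (g v) (g w)              ≡⟨ copy v w ⟩
    adjA v w                    ∎
    where open ≡-Reasoning

  module Restrict {A : Set} (g : A → Σ (Fin t) Vs) {i : Fin t} (in-i : ∀ a → proj₁ (g a) ≡ i) where

    restrict : A → Vs i
    restrict a = ≡-subst Vs (in-i a) (proj₂ (g a))

    restrict-edge : ∀ u v → edge (es i) (restrict u) (restrict v) ≡ ed (g u) (g v)
    restrict-edge u v = trans (sym (edge-within i _ _)) (cong₂ ed (sym (lift u)) (sym (lift v)))
      where
      lift : ∀ a → g a ≡ (i , restrict a)
      lift a with g a | in-i a
      ... | (j , w) | refl = refl

edge-sym : ∀ {V} (e : Expr V) u v → edge e u v ≡ edge e v u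
edge-sym circ                    ()
edge-sym bullet                  u        v        = refl
edge-sym (union t p Vs es)       u        v        =
  Composition.sym-edge (union-composition p) (λ _ _ → refl) (λ i → edge-sym (es i)) u v
edge-sym (join t p Vs es)        u        v        =
  Composition.sym-edge (join-composition p) (λ _ _ → refl) (λ i → edge-sym (es i)) u v
edge-sym (subst t H hs hi Vs es) u        v        =
  Composition.sym-edge (subst-composition H hs hi) hs (λ i → edge-sym (es i)) u v
edge-sym (inc e N)               nothing  nothing  = refl
edge-sym (inc e N)               nothing  (just v) = refl
edge-sym (inc e N)               (just u) nothing  = refl
edge-sym (inc e N)               (just u) (just v) = edge-sym e u v

edge-irrefl : ∀ {V} (e : Expr V) u → edge e u u ≡ false
edge-irrefl circ                    ()
edge-irrefl bullet                  u        = refl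
edge-irrefl (union t p Vs es)       (i , u)  =
  trans (IsComposition.edge-within (union-composition p) i u u) (edge-irrefl (es i) u)
edge-irrefl (join t p Vs es)        (i , u)  =
  trans (IsComposition.edge-within (join-composition p) i u u) (edge-irrefl (es i) u)
edge-irrefl (subst t H hs hi Vs es) (i , u)  =
  trans (IsComposition.edge-within (subst-composition H hs hi) i u u) (edge-irrefl (es i) u)
edge-irrefl (inc e N)               nothing  = refl
edge-irrefl (inc e N)               (just u) = edge-irrefl e u

Finite : Set → Set
Finite A = Σ ℕ λ n → A ↔ Fin n

Maybe↔⊤⊎ : {A : Set} → Maybe A ↔ (⊤ ⊎ A)
Maybe↔⊤⊎ = mk↔ₛ′ (maybe inj₂ (inj₁ tt)) [ const nothing , just ]
  (λ { (inj₁ tt) → refl ; (inj₂ a) → refl }) (λ { nothing → refl ; (just a) → refl })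

Σ-Fin-suc↔⊎ : ∀ {t} {Vs : Fin (suc t) → Set} → Σ (Fin (suc t)) Vs ↔ (Vs zero ⊎ Σ (Fin t) (Vs ∘ suc))
Σ-Fin-suc↔⊎ {t} {Vs} = mk↔ₛ′ split [ (zero ,_) , (λ { (i , v) → suc i , v }) ]
  (λ { (inj₁ v) → refl ; (inj₂ (i , v)) → refl }) (λ { (zero , v) → refl ; (suc i , v) → refl })
  where
  split : Σ (Fin (suc t)) Vs → Vs zero ⊎ Σ (Fin t) (Vs ∘ suc)
  split (zero , v)  = inj₁ v
  split (suc i , v) = inj₂ (i , v)

Maybe-finite : {A : Set} → Finite A → Finite (Maybe A)
Maybe-finite (n , A↔n) = suc n , ↔-trans Maybe↔⊤⊎ (↔-trans (↔-sym 1↔⊤ ⊎-↔ A↔n) (↔-sym +↔⊎))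

Σ-finite : ∀ {t} {Vs : Fin t → Set} → (∀ i → Finite (Vs i)) → Finite (Σ (Fin t) Vs)
Σ-finite {0}     fin = 0 , mk↔ₛ′ (λ ()) (λ ()) (λ ()) (λ ())
Σ-finite {suc t} fin with fin zero | Σ-finite (fin ∘ suc)
... | a , f | b , g = a + b , ↔-trans Σ-Fin-suc↔⊎ (↔-trans (f ⊎-↔ g) (↔-sym +↔⊎))

finite : ∀ {V} → Expr V → Finite V
finite circ                    = 0 , ↔-sym 0↔⊥
finite bullet                  = 1 , ↔-sym 1↔⊤
finite (union t p Vs es)       = Σ-finite (λ i → finite (es i))
finite (join t p Vs es)        = Σ-finite (λ i → finite (es i))
finite (subst t H hs hi Vs es) = Σ-finite (λ i → finite (es i))
finite (inc e N)               = Maybe-finite (finite e)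

graph : ∀ {V} → Expr V → Graph
graph e = record
  { n     = proj₁ (finite e)
  ; adj   = λ p q → edge e (from p) (from q)
  ; sym   = λ p q → edge-sym e (from p) (from q)
  ; irref = λ p → edge-irrefl e (from p)
  }
  where open Inverse (proj₂ (finite e))

graph-iso : ∀ {V} (e : Expr V) → IsoTo e (graph e)
graph-iso e = proj₂ (finite e) , λ u v → sym (cong₂ (edge e) (strictlyInverseʳ u) (strictlyInverseʳ v))
  where open Inverse (proj₂ (finite e))

module _ {V W : Set} (e : Expr V) (e′ : Expr W) (ι′ : IsoTo e′ (graph e)) where

  transport : V → W
  transport = Inverse.from (proj₁ ι′) ∘ Inverse.to (proj₂ (finite e))

  transport-edge : ∀ u v → edge e′ (transport u) (transport v) ≡ edge e u v
  transport-edge u v = begin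
    edge e′ (transport u) (transport v)
      ≡⟨ proj₂ ι′ (transport u) (transport v) ⟩
    adj (graph e) (to (from (to₀ u))) (to (from (to₀ v)))
      ≡⟨ cong₂ (adj (graph e)) (strictlyInverseˡ (to₀ u)) (strictlyInverseˡ (to₀ v)) ⟩
    adj (graph e) (to₀ u) (to₀ v)
      ≡⟨ sym (proj₂ (graph-iso e) u v) ⟩
    edge e u v ∎
    where
    open ≡-Reasoning
    open Inverse (proj₁ ι′)
    open Inverse (proj₂ (finite e)) using () renaming (to to to₀)

-- Cliques force Inc depth

IsClique : ∀ {V r} → Expr V → (Fin r → V) → Set
IsClique e K = ∀ i j → i ≢ j → edge e (K i) (K j) ≡ true

module _ {V : Set} (e : Expr V) (N : V → Bool) {r : ℕ} {K : Fin (suc r) → Maybe V}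
         (clique : IsClique (inc e N) K) where

  private
    unjust : (x : Maybe V) → x ≢ nothing → V
    unjust (just v) _   = v
    unjust nothing  x≢n = ⊥-elim (x≢n refl)

    adjacent : ∀ {x y} i j → i ≢ j → K i ≡ x → K j ≡ y → edge (inc e N) x y ≡ true
    adjacent i j i≢j refl refl = clique i j i≢j

  -- The new vertex x = nothing occurs at most once in K; if it is not K 0, we
  -- replace it by the vertex K 0, which is adjacent to every other clique vertex.
  clique-without-new-vertex : Σ (Fin r → V) (IsClique e)
  clique-without-new-vertex with K zero in eq₀
  ... | nothing = (λ j → unjust (K (suc j)) (old j))
                , λ i j i≢j → unjust-edge (old i) (old j) (clique _ _ (i≢j ∘ suc-injective))
    where
    old : ∀ j → K (suc j) ≢ nothing
    old j eqⱼ with () ← adjacent zero (suc j) (λ ()) eq₀ eqⱼ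
    unjust-edge : ∀ {x y} (px : x ≢ nothing) (py : y ≢ nothing) →
                  edge (inc e N) x y ≡ true → edge e (unjust x px) (unjust y py) ≡ true
    unjust-edge {just u} {just w} _ _ xy = xy
    unjust-edge {nothing} px _ _ = ⊥-elim (px refl)
    unjust-edge {just u} {nothing} _ py _ = ⊥-elim (py refl)
  ... | just v = (λ j → fromMaybe v (K (suc j))) , edges
    where
    edges : IsClique e (λ j → fromMaybe v (K (suc j)))
    edges i j i≢j with K (suc i) in eqᵢ | K (suc j) in eqⱼ
    ... | just x  | just y  = adjacent (suc i) (suc j) (i≢j ∘ suc-injective) eqᵢ eqⱼ
    ... | nothing | just y  = adjacent zero (suc j) (λ ()) eq₀ eqⱼ
    ... | just x  | nothing = adjacent (suc i) zero (λ ()) eqᵢ eq₀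
    ... | nothing | nothing with () ← adjacent (suc i) (suc j) (i≢j ∘ suc-injective) eqᵢ eqⱼ

clique≤incDepth : ∀ {V} (e : Expr V) → AllNodes TDops e → ∀ {r} {K : Fin r → V} → IsClique e K → r ≤ incDepth e
clique≤incDepth e ops {0} _ = z≤n
clique≤incDepth circ                    ops {suc r} {K} _ with () ← K zero
clique≤incDepth bullet                  ()
clique≤incDepth (join t p Vs es)        (() , _)
clique≤incDepth (subst t H hs hi Vs es) (() , _)
clique≤incDepth (inc e N)               (_ , ops) {suc r} {K} clique =
  s≤s (clique≤incDepth e ops (proj₂ (clique-without-new-vertex e N {K = K} clique)))
clique≤incDepth (union t p Vs es)       (_ , ops) {suc r} {K} clique =
  ≤-trans (clique≤incDepth (es c₀) (ops c₀) (λ i j i≢j → trans (restrict-edge i j) (clique i j i≢j)))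
          (maxFin-upper t (λ i → incDepth (es i)) c₀)
  where
  open Composition (union-composition {es = es} p)
  c₀ : Fin t
  c₀ = proj₁ (K zero)
  in-c₀ : ∀ i → proj₁ (K i) ≡ c₀
  in-c₀ i with i ≟ zero
  ... | yes refl = refl
  ... | no i≢0   = same-part (K i) (K zero) (≡true⇒≢false (clique i zero i≢0))
  open Restrict K in-c₀

-- Spiders are prime, so they do not occur in modular-width expressions

data Spider (m : ℕ) : Set where
  centre      : Spider m
  inner outer : Fin m → Spider m

spider-adj : ∀ {m} → Spider m → Spider m → Bool
spider-adj centre    (inner _) = true
spider-adj (inner _) centre    = true
spider-adj (inner i) (outer j) = does (i ≟ j)
spider-adj (outer i) (inner j) = does (i ≟ j)
spider-adj _         _         = false

module SpiderModules {m t : ℕ} {c : Spider m → Fin t} (modular : IsModular spider-adj c) where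

  separated : ∀ {u v} w → c u ≡ c v → spider-adj u w ≡ true → spider-adj v w ≡ false → c w ≡ c u
  separated w cu≡cv uw vw with c w ≟ c _
  ... | yes cw≡cu = cw≡cu
  ... | no cw≢cu  = ⊥-elim (≡true⇒≢false uw (trans (modular _ _ w cu≡cv cw≢cu) vw))

  centre-inner : ∀ i → c (inner i) ≡ c centre → ∀ w → c w ≡ c centre
  centre-inner i ci≡cc = class
    where
    outer-of : ∀ j → c (inner j) ≡ c centre → c (outer j) ≡ c centre
    outer-of j eq = trans (separated (outer j) eq (dec-true (j ≟ j) refl) refl) eq
    inner-of : ∀ j → c (inner j) ≡ c centre
    inner-of j with j ≟ i
    ... | yes refl = ci≡cc
    ... | no j≢i   = separated (inner j) (sym (outer-of i ci≡cc)) refl (dec-false (i ≟ j) (j≢i ∘ sym))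
    class : ∀ w → c w ≡ c centre
    class centre    = refl
    class (inner j) = inner-of j
    class (outer j) = outer-of j (inner-of j)

  inner-outer : ∀ {i j} → c (inner i) ≡ c (outer j) → ∀ w → c w ≡ c centre
  inner-outer {i} eq = centre-inner i (sym (separated centre eq refl refl))

  inner-inner : ∀ {i j} → i ≢ j → c (inner i) ≡ c (inner j) → ∀ w → c w ≡ c centre
  inner-inner {i} {j} i≢j eq = centre-inner i (sym (separated centre (sym outer-i) refl refl))
    where
    outer-i : c (outer i) ≡ c (inner i)
    outer-i = separated (outer i) eq (dec-true (i ≟ i) refl) (dec-false (j ≟ i) (i≢j ∘ sym))

IsInducedCopy : ∀ {A V} → (A → A → Bool) → Expr V → (A → V) → Set
IsInducedCopy adjA e g = ∀ u v → edge e (g u) (g v) ≡ adjA u v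

no-spider-in-MW : ∀ h {V} (e : Expr V) → AllNodes (MWops h) e →
                  (g : Spider (suc (suc h)) → V) → ¬ IsInducedCopy spider-adj e g
no-spider-in-MW h circ                    _        g copy with () ← g centre
no-spider-in-MW h bullet                  _        g copy with () ← copy centre (inner zero)
no-spider-in-MW h (inc e N)               (() , _)
no-spider-in-MW h (union t p Vs es)       (_ , ops) g copy =
  no-spider-in-MW h (es _) (ops _) restrict (λ u v → trans (restrict-edge u v) (copy u v))
  where
  open Composition (union-composition {es = es} p)
  centre~inner : proj₁ (g centre) ≡ proj₁ (g (inner zero))
  centre~inner = same-part (g centre) (g (inner zero)) (≡true⇒≢false (copy centre (inner zero)))
  open Restrict g (SpiderModules.centre-inner (modular g copy) zero (sym centre~inner))
no-spider-in-MW h (join t p Vs es)        (_ , ops) g copy =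
  no-spider-in-MW h (es _) (ops _) restrict (λ u v → trans (restrict-edge u v) (copy u v))
  where
  open Composition (join-composition {es = es} p)
  inner~outer : proj₁ (g (inner zero)) ≡ proj₁ (g (outer (suc zero)))
  inner~outer = same-part (g (inner zero)) (g (outer (suc zero))) (≡false⇒≢true (copy (inner zero) (outer (suc zero))))
  open Restrict g (SpiderModules.inner-outer (modular g copy) inner~outer)
no-spider-in-MW h (subst t H hs hi Vs es) (t≤h , ops) g copy
  with i , j , i<j , inner~inner ← pigeonhole (s≤s (≤-trans t≤h (n≤1+n h))) (λ i → proj₁ (g (inner i))) =
  no-spider-in-MW h (es _) (ops _) restrict (λ u v → trans (restrict-edge u v) (copy u v))
  where
  open Composition (subst-composition {es = es} H hs hi)
  open Restrict g (SpiderModules.inner-inner (modular g copy) (<⇒≢ i<j) inner~inner)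

graph-nonempty : ∀ {V} (e : Expr V) → V → n (graph e) ≢ 0
graph-nonempty e v n≡0 with () ← ≡-subst Fin n≡0 (Inverse.to (proj₂ (finite e)) v)

clique⇒¬TD : ∀ {k V} (e : Expr V) {r} {K : Fin r → V} → k < r → IsClique e K → ¬ TD k (graph e)
clique⇒¬TD e {K = K} (s≤s _) clique (inj₁ n≡0) = graph-nonempty e (K zero) n≡0
clique⇒¬TD e {K = K} k<r     clique (inj₂ (_ , e′ , ops , depth , ι′)) =
  <⇒≱ k<r (≤-trans (clique≤incDepth e′ ops {K = transport e e′ ι′ ∘ K} clique′) depth)
  where
  clique′ : IsClique e′ (transport e e′ ι′ ∘ K)
  clique′ i j i≢j = trans (transport-edge e e′ ι′ (K i) (K j)) (clique i j i≢j)

spider⇒¬MW : ∀ {h V} (e : Expr V) {g : Spider (suc (suc h)) → V} → IsInducedCopy spider-adj e g → ¬ MW h (graph e)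
spider⇒¬MW e {g} copy (inj₁ n≡0) = graph-nonempty e (g centre) n≡0
spider⇒¬MW {h} e {g} copy (inj₂ (_ , e′ , ops , _ , ι′)) =
  no-spider-in-MW h e′ ops (transport e e′ ι′ ∘ g) (λ u v → trans (transport-edge e e′ ι′ (g u) (g v)) (copy u v))

-- The witness: a clique next to a spider

two≤ : ∀ {t} → 2 ≤ suc (suc t)
two≤ = s≤s (s≤s z≤n)

_⊕_ : ∀ {A B} → Expr A → Expr B → Expr (Σ (Fin 2) (A ∷ B ∷ []))
a ⊕ b = union 2 two≤ _ λ { zero → a ; (suc zero) → b }

complete : (r : ℕ) → Expr (Fin (suc (suc r)) × ⊤)
complete r = join (suc (suc r)) two≤ (λ _ → ⊤) (λ _ → bullet)

complete-clique : ∀ r → IsClique (complete r) (_, tt)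
complete-clique r i j i≢j rewrite dec-no (i ≟ j) i≢j = refl

complete-depth : ∀ r → incDepth (complete r) ≤ 0
complete-depth r = maxFin-lub (suc (suc r)) (λ _ → 0) (λ _ → z≤n)

spider : (m : ℕ) → 2 ≤ m → Expr (Maybe (Fin m × (Fin 2 × ⊤)))
spider m p = inc (union m p (λ _ → Fin 2 × ⊤) (λ _ → complete 0)) λ where
  (_ , zero , _)  → true
  (_ , suc _ , _) → false

spider-vertex : ∀ {m} → Spider m → Maybe (Fin m × (Fin 2 × ⊤))
spider-vertex centre    = nothing
spider-vertex (inner i) = just (i , zero , tt)
spider-vertex (outer i) = just (i , suc zero , tt)

spider-copy : ∀ m p → IsInducedCopy spider-adj (spider m p) spider-vertex
spider-copy m p centre    centre    = refl
spider-copy m p centre    (inner j) = refl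
spider-copy m p centre    (outer j) = refl
spider-copy m p (inner i) centre    = refl
spider-copy m p (outer i) centre    = refl
spider-copy m p (inner i) (inner j) with i ≟ j
... | yes refl = refl
... | no _     = refl
spider-copy m p (inner i) (outer j) with i ≟ j
... | yes refl = refl
... | no _     = refl
spider-copy m p (outer i) (inner j) with i ≟ j
... | yes refl = refl
... | no _     = refl
spider-copy m p (outer i) (outer j) with i ≟ j
... | yes refl = refl
... | no _     = refl

witness : (k h : ℕ) → Expr (Σ (Fin 2) ((Fin (suc (suc k)) × ⊤) ∷ Maybe (Fin (suc (suc h)) × (Fin 2 × ⊤)) ∷ []))
witness k h = complete k ⊕ spider (suc (suc h)) two≤

witness-TDMW : ∀ k h → TDMW 1 0 (graph (witness k h))
witness-TDMW k h = inj₂ (_ , witness k h , ops , depth , graph-iso (witness k h))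
  where
  ops : AllNodes (TDMWops 0) (witness k h)
  ops = tt , λ { zero → tt , (λ _ → tt) ; (suc zero) → tt , tt , λ _ → tt , λ _ → tt }
  depth : incDepth (witness k h) ≤ 1
  depth = ⊔-lub (≤-trans (complete-depth k) z≤n)
                (⊔-lub (s≤s (maxFin-lub (suc (suc h)) (λ _ → incDepth (complete 0)) λ _ → complete-depth 0)) z≤n)

lemma26 : (k h : ℕ) → Σ Graph λ G → ¬ TD k G × ¬ MW h G × TDMW 1 0 G
lemma26 k h = graph (witness k h)
            , clique⇒¬TD (witness k h) {K = λ i → zero , i , tt} (s≤s (n≤1+n k)) (complete-clique k)
            , spider⇒¬MW (witness k h) {g = λ u → suc zero , spider-vertex u} (spider-copy _ two≤)
            , witness-TDMW k h
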